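{- An ultrafilter $\mathcal{U}$ on $\mathbb{N}$ satisfies $\mathcal{V}\leq_{fe}\mathcal{U}$ for every ultrafilter $\mathcal{V}$ on $\mathbb{N}$ if and only if every $A\in\mathcal{U}$ is piecewise syndetic.
   Context: $\mathbb{N}=\{0,1,2,\dots\}$. For $A,B\subseteq\mathbb{N}$, $A\leq_{fe}B$ means that for every finite $F\subseteq A$ there is $k\in\mathbb{N}$ with $F+k\subseteq B$. For ultrafilters, $\mathcal{U}\leq_{fe}\mathcal{V}$ means that for every $B\in\mathcal{V}$ there is $A\in\mathcal{U}$ with $A\leq_{fe}B$. A set $T\subseteq\mathbb{N}$ is thick if it contains arbitrarily long intervals of consecutive integers; $A\subseteq\mathbb{N}$ is piecewise syndetic if there is $n\in\mathbb{N}$ such that $\bigcup_{i=1}^{n}(A+i)$ is thick (equivalently, $A\cup(A-1)\cup\dots\cup(A-n)$ is thick for some $n$). -}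

module Defs where

open import Level using (0ℓ)
open import Data.Nat using (ℕ; _+_; _≤_; _<_)
open import Data.Product using (Σ; ∃; _×_)
open import Data.Sum using (_⊎_)
open import Data.List using (List)
open import Data.List.Relation.Unary.All using (All)
open import Relation.Nullary using (¬_; Dec)
open import Relation.Unary using (Pred; _⊆_; _∩_; ∁; U; ∅)
open import Relation.Binary.PropositionalEquality using (_≡_)

Subset : Set₁
Subset = Pred ℕ 0ℓ

_≤fe_ : Subset → Subset → Set
A ≤fe B = (F : List ℕ) → All A F → ∃ λ k → All (λ x → B (x + k)) F

record Ultrafilter : Set₁ where
  field
    member   : Subset → Set
    has-full : member U
    no-empty : ¬ member ∅
    upward   : ∀ {A B} → A ⊆ B → member A → member B
    inter    : ∀ {A B} → member A → member B → member (A ∩ B)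
    ultra    : ∀ A → member A ⊎ member (∁ A)
open Ultrafilter public

_≤ᵤfe_ : Ultrafilter → Ultrafilter → Set₁
𝓤 ≤ᵤfe 𝓥 = ∀ B → member 𝓥 B → Σ Subset λ A → member 𝓤 A × (A ≤fe B)

Thick : Subset → Set
Thick T = ∀ L → ∃ λ a → ∀ i → i < L → T (a + i)

_⊕_ : Subset → ℕ → Subset
(A ⊕ i) x = ∃ λ a → A a × x ≡ a + i

PiecewiseSyndetic : Subset → Set
PiecewiseSyndetic A = ∃ λ n → Thick (λ x → ∃ λ i → 1 ≤ i × i ≤ n × (A ⊕ i) x)

-- Classical ambient foundations of the paper (ZFC), made explicit.
ExcludedMiddle : Set₁
ExcludedMiddle = (P : Set) → Dec P

FIP : (Subset → Set) → Set₁
FIP 𝓕 = (Fs : List Subset) → All 𝓕 Fs → ∃ λ x → All (λ F → F x) Fs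

UltrafilterLemma : Set₁
UltrafilterLemma = (𝓕 : Subset → Set) → FIP 𝓕 →
  Σ Ultrafilter λ 𝓤 → ∀ F → 𝓕 F → member 𝓤 F

-- (⇐) Given B ∈ 𝓤 with B ⊕ 1 ∪ … ∪ B ⊕ n thick, take intervals of every length L inside that union
-- and a nonprincipal ultrafilter 𝓦 on the lengths. Passing to the 𝓦-limit of the intervals covers
-- ℕ by n sets, one per shift i, and any finite subset of the i-th set lies, shifted by a common
-- amount, inside B; an arbitrary ultrafilter 𝓥 contains one of the n sets.
-- (⇒) If A ∈ 𝓤 is not piecewise syndetic, the sets C with ∁ C ≤fe A have the finite intersection
-- property: intersecting a thick set with such a C keeps it thick, since otherwise the points of ∁ C
-- in long intervals, translated into A, would make A piecewise syndetic. An ultrafilter 𝓥 containing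
-- all these sets contains ∁ C for every C ≤fe A, so it has no member ≤fe A.

module Submission where

open import Defs
open import Function.Base using (id)
open import Function.Bundles using (_⇔_; mk⇔)
open import Data.Nat using (ℕ; zero; suc; _+_; _∸_; _≤_; _<_; _⊔_; z≤n; s≤s; _≟_)
open import Data.Nat.Properties
open import Data.Nat.Tactic.RingSolver using (solve-∀)
open import Data.Product using (Σ; ∃; _×_; _,_; proj₁; proj₂)
open import Data.Sum using (inj₁; inj₂)
open import Data.Unit using (tt)
open import Data.Empty using (⊥-elim)
open import Data.List using (List; []; _∷_; filter; applyUpTo)
open import Data.List.Relation.Unary.All as All using (All; []; _∷_)
open import Data.List.Relation.Unary.All.Properties using (all-filter)
open import Data.List.Membership.Propositional.Properties using (∈-filter⁺; ∈-applyUpTo⁺)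
open import Relation.Nullary using (¬_; yes; no)
open import Relation.Unary using (Decidable; _⊆_; _∩_; ∁; U)
open import Relation.Binary.PropositionalEquality
  using (_≡_; refl; sym; trans; cong; subst; module ≡-Reasoning)

module _ (em : ExcludedMiddle) where

  dne : {P : Set} → ¬ ¬ P → P
  dne {P} ¬¬p with em P
  ... | yes p = p
  ... | no ¬p = ⊥-elim (¬¬p ¬p)

  ¬∀⇒∃¬ : {A : Set} {P : A → Set} → ¬ (∀ x → P x) → ∃ λ x → ¬ P x
  ¬∀⇒∃¬ ¬∀ = dne λ ¬∃ → ¬∀ λ x → dne λ ¬Px → ¬∃ (x , ¬Px)

  ¬→⇒×¬ : {Q P : Set} → ¬ (Q → P) → Q × ¬ P
  ¬→⇒×¬ ¬→ = dne (λ ¬q → ¬→ λ q → ⊥-elim (¬q q)) , λ p → ¬→ λ _ → p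

  member⇒nonempty : (𝓦 : Ultrafilter) {P : Subset} → member 𝓦 P → ∃ P
  member⇒nonempty 𝓦 P∈𝓦 = dne λ ¬∃ → no-empty 𝓦 (upward 𝓦 (λ Px → ¬∃ (_ , Px)) P∈𝓦)

AmongFirst : ℕ → (ℕ → Set) → Set
AmongFirst n P = ∃ λ i → 1 ≤ i × i ≤ n × P i

member-All : (𝓦 : Ultrafilter) (S : ℕ → Subset) (F : List ℕ) →
  All (λ y → member 𝓦 (S y)) F → member 𝓦 (λ x → All (λ y → S y x) F)
member-All 𝓦 S []      []       = upward 𝓦 (λ _ → []) (has-full 𝓦)
member-All 𝓦 S (_ ∷ F) (p ∷ ps) = upward 𝓦 (λ (s , ss) → s ∷ ss) (inter 𝓦 p (member-All 𝓦 S F ps))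

member-AmongFirst : (𝓦 : Ultrafilter) (n : ℕ) {P : ℕ → Subset} →
  member 𝓦 (λ x → AmongFirst n λ i → P i x) → AmongFirst n λ i → member 𝓦 (P i)
member-AmongFirst 𝓦 zero ⋃∈𝓦 = ⊥-elim (no-empty 𝓦 (upward 𝓦 (λ { (suc _ , _ , () , _) }) ⋃∈𝓦))
member-AmongFirst 𝓦 (suc n) {P} ⋃∈𝓦 with ultra 𝓦 (P (suc n))
... | inj₁ last∈𝓦 = suc n , s≤s z≤n , ≤-refl , last∈𝓦
... | inj₂ ∁last∈𝓦 with member-AmongFirst 𝓦 n (upward 𝓦 dropLast (inter 𝓦 ⋃∈𝓦 ∁last∈𝓦))
  where
  dropLast : ∀ {x} → (AmongFirst (suc n) λ i → P i x) × ¬ P (suc n) x → AmongFirst n λ i → P i x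
  dropLast ((i , 1≤i , i≤1+n , p) , ¬last) with i ≟ suc n
  ... | yes refl = ⊥-elim (¬last p)
  ... | no  i≢1+n = i , 1≤i , ≤-pred (≤∧≢⇒< i≤1+n i≢1+n) , p
... | i , 1≤i , i≤n , p = i , 1≤i , m≤n⇒m≤1+n i≤n , p

ContainsTail : Subset → Set
ContainsTail C = ∃ λ m → ∀ x → m ≤ x → C x

common-tail : (Cs : List Subset) → All ContainsTail Cs → ∃ λ m → ∀ x → m ≤ x → All (λ C → C x) Cs
common-tail []       []                     = 0 , λ _ _ → []
common-tail (C ∷ Cs) ((m , tail) ∷ tails) with common-tail Cs tails
... | m′ , tail′ = m ⊔ m′ , λ x m⊔m′≤x →
  tail x (≤-trans (m≤m⊔n m m′) m⊔m′≤x) ∷ tail′ x (≤-trans (m≤n⊔m m m′) m⊔m′≤x)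

tails-FIP : FIP ContainsTail
tails-FIP Cs tails with common-tail Cs tails
... | m , tail = m , tail m ≤-refl

nonprincipal-ultrafilter : UltrafilterLemma → Σ Ultrafilter λ 𝓦 → ∀ m → member 𝓦 (m ≤_)
nonprincipal-ultrafilter ul with ul ContainsTail tails-FIP
... | 𝓦 , ⊇tails = 𝓦 , λ m → ⊇tails (m ≤_) (m , λ _ → id)

⊆-≤fe-trans : {A′ A B : Subset} → A′ ⊆ A → A ≤fe B → A′ ≤fe B
⊆-≤fe-trans A′⊆A A≤feB F A′F = A≤feB F (All.map A′⊆A A′F)

shift-back : ∀ {y a n i b} → i ≤ n → a + (n + y) ≡ b + i → y + (a + n ∸ i) ≡ b
shift-back {y} {a} {n} {i} {b} i≤n a+n+y≡b+i = begin
  y + (a + n ∸ i)  ≡⟨ sym (+-∸-assoc y (≤-trans i≤n (m≤n+m n a))) ⟩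
  y + (a + n) ∸ i  ≡⟨ cong (_∸ i) (trans (+-comm y (a + n)) (+-assoc a n y)) ⟩
  a + (n + y) ∸ i  ≡⟨ cong (_∸ i) a+n+y≡b+i ⟩
  b + i ∸ i        ≡⟨ m+n∸n≡m b i ⟩
  b                ∎
  where open ≡-Reasoning

-- y ∈ Good i when, for 𝓦-almost every L, the chosen interval of length L in the union of the
-- B ⊕ i has its point at offset n + y in B ⊕ i; the offset n keeps the shift back to B nonnegative.
piecewiseSyndetic⇒≤fe-member : ExcludedMiddle → (𝓦 : Ultrafilter) → (∀ m → member 𝓦 (m ≤_)) →
  {B : Subset} → PiecewiseSyndetic B → (𝓥 : Ultrafilter) → Σ Subset λ A → member 𝓥 A × A ≤fe B
piecewiseSyndetic⇒≤fe-member em 𝓦 tails {B} (n , thick) 𝓥 =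
  fromIndex (member-AmongFirst 𝓥 n (upward 𝓥 (λ _ → member-AmongFirst 𝓦 n (covered _)) (has-full 𝓥)))
  where
  a : ℕ → ℕ
  a L = proj₁ (thick L)
  Hit : ℕ → ℕ → Subset
  Hit i y L = (B ⊕ i) (a L + (n + y))
  Good : ℕ → Subset
  Good i y = member 𝓦 (Hit i y)
  covered : ∀ y → member 𝓦 λ L → AmongFirst n λ i → Hit i y L
  covered y = upward 𝓦 (λ {L} → proj₂ (thick L) (n + y)) (tails (suc (n + y)))
  Good≤feB : ∀ {i} → i ≤ n → Good i ≤fe B
  Good≤feB {i} i≤n F Good-F with member⇒nonempty em 𝓦 (member-All 𝓦 (Hit i) F Good-F)
  ... | L , hits = a L + n ∸ i , All.map (λ (b , Bb , eq) → subst B (sym (shift-back i≤n eq)) Bb) hits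
  fromIndex : (AmongFirst n λ i → member 𝓥 (Good i)) → Σ Subset λ A → member 𝓥 A × A ≤fe B
  fromIndex (i , _ , i≤n , Good∈𝓥) = Good i , Good∈𝓥 , Good≤feB i≤n

realign : ∀ a k L j {i} → i ≤ L → a + k + L + j ≡ a + (j + i) + k + (L ∸ i)
realign a k L j {i} i≤L = begin
  a + k + L + j                  ≡⟨ cong (λ l → a + k + l + j) (sym (m+[n∸m]≡n i≤L)) ⟩
  a + k + (i + (L ∸ i)) + j      ≡⟨ regroup a k j i (L ∸ i) ⟩
  a + (j + i) + k + (L ∸ i)      ∎
  where
  open ≡-Reasoning
  regroup : ∀ a k j i d → a + k + (i + d) + j ≡ a + (j + i) + k + d
  regroup = solve-∀

-- If T is thick but T ∩ C has no interval of length L, every window of length L in T meets ∁ C.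
-- Translating the points of ∁ C in one long interval of T into A makes the union of A ⊕ 1, …, A ⊕ L
-- contain the translated interval.
piecewiseSyndetic-of-gaps : ExcludedMiddle → {A C T : Subset} → Thick T → ∁ C ≤fe A →
  (L : ℕ) → (∀ a → ¬ (∀ i → i < L → (T ∩ C) (a + i))) → PiecewiseSyndetic A
piecewiseSyndetic-of-gaps em {A} {C} {T} thickT ∁C≤feA L gaps = L , thick
  where
  ∉C? : Decidable (∁ C)
  ∉C? x = em (¬ C x)
  translateHoles : ∀ a N → ∃ λ k → All (λ x → A (x + k)) (filter ∉C? (applyUpTo (a +_) N))
  translateHoles a N = ∁C≤feA _ (all-filter ∉C? (applyUpTo (a +_) N))
  thick : Thick λ x → AmongFirst L λ i → (A ⊕ i) x
  thick M with thickT (M + L)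
  ... | a , interval with translateHoles a (M + L)
  ... | k , translated = a + k + L , covered
    where
    window<M+L : ∀ {j i} → j < M → i < L → j + i < M + L
    window<M+L j<M i<L = +-mono-<-≤ j<M (<⇒≤ i<L)
    hole : ∀ {j} → j < M → ∃ λ i → i < L × ¬ C (a + (j + i))
    hole {j} j<M with ¬∀⇒∃¬ em (λ inC → gaps (a + j) λ i i<L →
                        subst (T ∩ C) (sym (+-assoc a j i)) (interval (j + i) (window<M+L j<M i<L) , inC i i<L))
    ... | i , ¬[i<L→C] = i , ¬→⇒×¬ em ¬[i<L→C]
    covered : ∀ j → j < M → AmongFirst L λ i → (A ⊕ i) (a + k + L + j)
    covered j j<M with hole j<M
    ... | i , i<L , ∉C = L ∸ i , m<n⇒0<n∸m i<L , m∸n≤m L i , a + (j + i) + k ,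
      All.lookup translated (∈-filter⁺ ∉C? (∈-applyUpTo⁺ (a +_) (window<M+L j<M i<L)) ∉C) ,
      realign a k L j (<⇒≤ i<L)

thick-∩-of-not-piecewiseSyndetic : ExcludedMiddle → {A C T : Subset} → ¬ PiecewiseSyndetic A →
  ∁ C ≤fe A → Thick T → Thick (T ∩ C)
thick-∩-of-not-piecewiseSyndetic em {A} {C} {T} ¬psA ∁C≤feA thickT = dne em λ ¬thick →
  let L , noInterval = ¬∀⇒∃¬ em ¬thick
  in ¬psA (piecewiseSyndetic-of-gaps em {A} {C} {T} thickT ∁C≤feA L λ a inside → noInterval (a , inside))

thick-meets-all : ExcludedMiddle → {A T : Subset} → ¬ PiecewiseSyndetic A → Thick T →
  (Cs : List Subset) → All (λ C → ∁ C ≤fe A) Cs → ∃ λ x → T x × All (λ C → C x) Cs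
thick-meets-all em ¬psA thickT [] [] = _ , proj₂ (thickT 1) 0 (s≤s z≤n) , []
thick-meets-all em {A} {T} ¬psA thickT (C ∷ Cs) (∁C≤feA ∷ rest)
  with thick-meets-all em {T = T ∩ C} ¬psA (thick-∩-of-not-piecewiseSyndetic em {A} {C} {T} ¬psA ∁C≤feA thickT) Cs rest
... | x , (Tx , Cx) , Csx = x , Tx , Cx ∷ Csx

complements-≤fe-FIP : ExcludedMiddle → {A : Subset} → ¬ PiecewiseSyndetic A → FIP λ C → ∁ C ≤fe A
complements-≤fe-FIP em ¬psA Cs ∁Cs≤feA with thick-meets-all em {T = U} ¬psA (λ _ → 0 , λ _ _ → tt) Cs ∁Cs≤feA
... | x , _ , Csx = x , Csx

below-all⇒piecewiseSyndetic : ExcludedMiddle → UltrafilterLemma → (𝓤 : Ultrafilter) →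
  ((𝓥 : Ultrafilter) → 𝓥 ≤ᵤfe 𝓤) → (A : Subset) → member 𝓤 A → PiecewiseSyndetic A
below-all⇒piecewiseSyndetic em ul 𝓤 below A A∈𝓤 = dne em λ ¬psA →
  let 𝓥 , 𝓥⊇ = ul _ (complements-≤fe-FIP em ¬psA)
      C , C∈𝓥 , C≤feA = below 𝓥 A A∈𝓤
      ∁C∈𝓥 = 𝓥⊇ (∁ C) (⊆-≤fe-trans {∁ (∁ C)} {C} {A} (dne em) C≤feA)
  in no-empty 𝓥 (upward 𝓥 (λ (c , ¬c) → ¬c c) (inter 𝓥 C∈𝓥 ∁C∈𝓥))

corollary28 : ExcludedMiddle → UltrafilterLemma → (𝓤 : Ultrafilter) →
    ((𝓥 : Ultrafilter) → 𝓥 ≤ᵤfe 𝓤) ⇔ ((A : Subset) → member 𝓤 A → PiecewiseSyndetic A)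
corollary28 em ul 𝓤 = mk⇔ (below-all⇒piecewiseSyndetic em ul 𝓤) λ ps 𝓥 B B∈𝓤 →
  piecewiseSyndetic⇒≤fe-member em 𝓦 tails (ps B B∈𝓤) 𝓥
  where
  𝓦 = proj₁ (nonprincipal-ultrafilter ul)
  tails = proj₂ (nonprincipal-ultrafilter ul)
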